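{- Let $G$ be a finite simple graph and let $u_1,u_2,w_1,w_2$ be distinct vertices of $G$ such that $N(u_1)\cap N(u_2)\neq\emptyset$ and $N(w_1)\cap N(w_2)\neq\emptyset$. Suppose that (i) $N(u_1)\setminus N(u_2)$, $N(u_2)\setminus N(u_1)$, $N(w_1)\setminus N(w_2)$ and $N(w_2)\setminus N(w_1)$ are all nonempty; (ii) $N(w_1)\setminus N(w_2)\subseteq N(u_1)\setminus N(u_2)$ and $N(u_2)\setminus N(u_1)\subseteq N(w_2)\setminus N(w_1)$; and (iii) $\big|(N(u_1)\setminus N(u_2))\setminus (N(w_1)\setminus N(w_2))\big| + \big|(N(w_2)\setminus N(w_1))\setminus (N(u_2)\setminus N(u_1))\big| \geq 1$. Then $G$ is non-distance magic.
   Context: For a vertex $u$ of a graph $G$, $N(u)=\{v\in V(G): uv\in E(G)\}$ is its open neighbourhood. If $G$ is a simple graph of order $n$, a bijection $f:V(G)\to\{1,2,\ldots,n\}$ is a distance magic labeling of $G$ if $\sum_{v\in N(u)} f(v)$ is the same constant for all $u\in V(G)$. $G$ is distance magic if it has such a labeling, and non-distance magic (NDM) otherwise. -}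

module Defs where

open import Data.Nat using (ℕ; zero; suc; _+_)
open import Data.Fin using (Fin; toℕ)
open import Data.List using (List; map; filter; length)
open import Data.Nat.ListAction using (sum)
open import Data.List.Base using (allFin)
open import Data.Product using (Σ; ∃; _×_; _,_)
open import Data.Empty using (⊥)
open import Relation.Nullary using (¬_; Dec; yes; no)
open import Relation.Nullary.Decidable using (_×-dec_; ¬?)
open import Relation.Unary using (Pred; Decidable)
open import Relation.Binary.PropositionalEquality using (_≡_)
open import Level using (0ℓ)
open import Function.Bundles using (_⤖_; Bijection)

record SimpleGraph (n : ℕ) : Set₁ where
  field
    Adj   : Fin n → Fin n → Set
    adj?  : (u v : Fin n) → Dec (Adj u v)
    sym   : ∀ {u v} → Adj u v → Adj v u
    irrefl : ∀ {u} → ¬ Adj u u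

module _ {n : ℕ} (G : SimpleGraph n) where
  open SimpleGraph G

  N : Fin n → Pred (Fin n) 0ℓ
  N u v = Adj u v

  N? : (u : Fin n) → Decidable (N u)
  N? u v = adj? u v

  nbrSum : (Fin n → Fin n) → Fin n → ℕ
  nbrSum f u = sum (map (λ v → suc (toℕ (f v))) (filter (N? u) (allFin n)))

  -- distance magic labeling: bijection V(G) → {1,…,n} (encoded as Fin n via +1)
  -- with constant neighbourhood label sums
  IsDistanceMagicLabeling : (Fin n ⤖ Fin n) → Set
  IsDistanceMagicLabeling f =
    Σ ℕ λ k → ∀ u → nbrSum (Bijection.to f) u ≡ k

  DistanceMagic : Set
  DistanceMagic = Σ (Fin n ⤖ Fin n) IsDistanceMagicLabeling

  NonDistanceMagic : Set
  NonDistanceMagic = ¬ DistanceMagic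

module _ {n : ℕ} where
  _∖_ : Pred (Fin n) 0ℓ → Pred (Fin n) 0ℓ → Pred (Fin n) 0ℓ
  (A ∖ B) v = A v × ¬ B v

  _∩_ : Pred (Fin n) 0ℓ → Pred (Fin n) 0ℓ → Pred (Fin n) 0ℓ
  (A ∩ B) v = A v × B v

  Nonempty : Pred (Fin n) 0ℓ → Set
  Nonempty A = ∃ λ v → A v

  _⊆_ : Pred (Fin n) 0ℓ → Pred (Fin n) 0ℓ → Set
  A ⊆ B = ∀ {v} → A v → B v

  card : (A : Pred (Fin n) 0ℓ) → Decidable A → ℕ
  card A A? = length (filter A? (allFin n))

  ∖? : {A B : Pred (Fin n) 0ℓ} → Decidable A → Decidable B → Decidable (A ∖ B)
  ∖? A? B? v = A? v ×-dec ¬? (B? v)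

-- In a distance magic labeling the label sums over N(u) and N(v) agree, and so
-- do those over the common part N(u) ∩ N(v); hence the labels on N(u₁) ∖ N(u₂)
-- and on N(u₂) ∖ N(u₁) have the same total, and likewise for w₁, w₂. Writing
-- A, B, C, D for the four differences, (ii) gives
--   w(A) = w(C) + w(A ∖ C) = w(D) + w(A ∖ C) = w(B) + w(D ∖ B) + w(A ∖ C),
-- so w(A ∖ C) + w(D ∖ B) = 0. Labels are positive, so both sets are empty,
-- contradicting (iii).
module Submission where

open import Defs
open import Level using (Level)
open import Data.Nat using (ℕ; _+_; _≥_; _≤_; suc; s≤s; z≤n)
open import Data.Nat.Properties
  using (+-assoc; +-comm; +-identityʳ; +-cancelˡ-≡; +-mono-≤; ≤-trans; ≤-reflexive)
open import Data.Nat.ListAction using (sum)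
open import Data.Fin using (Fin; toℕ)
open import Data.List using (List; []; _∷_; map; filter; length; allFin)
open import Data.List.Properties using (filter-≐)
open import Data.Product using (_,_; proj₂; swap)
open import Function.Bundles using (Bijection; _⤖_)
open import Relation.Nullary using (¬_; yes; no; contradiction)
open import Relation.Unary using (Pred; Decidable; _≐_)
open import Relation.Unary.Properties using (_∩?_; ∁?)
open import Relation.Binary.PropositionalEquality using (_≡_; refl; sym; trans; cong; module ≡-Reasoning)

module _ {a} {A : Set a} (w : A → ℕ) where

  private variable
    p q r s : Level
    P : Pred A p
    Q : Pred A q
    R : Pred A r
    S : Pred A s

  weight : Decidable P → List A → ℕ
  weight P? xs = sum (map w (filter P? xs))

  weight-≐ : (P? : Decidable P) (Q? : Decidable Q) → P ≐ Q → ∀ xs → weight P? xs ≡ weight Q? xs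
  weight-≐ P? Q? P≐Q xs = cong (λ ys → sum (map w ys)) (filter-≐ P? Q? P≐Q xs)

  weight-split : (P? : Decidable P) (Q? : Decidable Q) →
                 ∀ xs → weight P? xs ≡ weight (P? ∩? Q?) xs + weight (P? ∩? ∁? Q?) xs
  weight-split P? Q? [] = refl
  weight-split P? Q? (x ∷ xs) with P? x | Q? x
  ... | no _  | _     = weight-split P? Q? xs
  ... | yes _ | yes _ = begin
    w x + weight P? xs       ≡⟨ cong (w x +_) (weight-split P? Q? xs) ⟩
    w x + (inter + diff)     ≡⟨ +-assoc (w x) inter diff ⟨
    w x + inter + diff       ∎
    where open ≡-Reasoning
          inter diff : ℕ
          inter = weight (P? ∩? Q?) xs
          diff  = weight (P? ∩? ∁? Q?) xs
  ... | yes _ | no _  = begin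
    w x + weight P? xs       ≡⟨ cong (w x +_) (weight-split P? Q? xs) ⟩
    w x + (inter + diff)     ≡⟨ +-assoc (w x) inter diff ⟨
    w x + inter + diff       ≡⟨ cong (_+ diff) (+-comm (w x) inter) ⟩
    inter + w x + diff       ≡⟨ +-assoc inter (w x) diff ⟩
    inter + (w x + diff)     ∎
    where open ≡-Reasoning
          inter diff : ℕ
          inter = weight (P? ∩? Q?) xs
          diff  = weight (P? ∩? ∁? Q?) xs

  weight-⊆ : (P? : Decidable P) (Q? : Decidable Q) → (∀ {x} → Q x → P x) →
             ∀ xs → weight P? xs ≡ weight Q? xs + weight (P? ∩? ∁? Q?) xs
  weight-⊆ P? Q? Q⊆P xs = begin
    weight P? xs                                       ≡⟨ weight-split P? Q? xs ⟩
    weight (P? ∩? Q?) xs + weight (P? ∩? ∁? Q?) xs     ≡⟨ cong (_+ weight (P? ∩? ∁? Q?) xs) (weight-≐ (P? ∩? Q?) Q? (proj₂ , λ q → Q⊆P q , q) xs) ⟩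
    weight Q? xs + weight (P? ∩? ∁? Q?) xs             ∎
    where open ≡-Reasoning

  weight-∖-cancel : (P? : Decidable P) (Q? : Decidable Q) → ∀ xs → weight P? xs ≡ weight Q? xs →
                    weight (P? ∩? ∁? Q?) xs ≡ weight (Q? ∩? ∁? P?) xs
  weight-∖-cancel P? Q? xs wP≡wQ = +-cancelˡ-≡ (weight (P? ∩? Q?) xs) _ _ (begin
    weight (P? ∩? Q?) xs + weight (P? ∩? ∁? Q?) xs     ≡⟨ weight-split P? Q? xs ⟨
    weight P? xs                                       ≡⟨ wP≡wQ ⟩
    weight Q? xs                                       ≡⟨ weight-split Q? P? xs ⟩
    weight (Q? ∩? P?) xs + weight (Q? ∩? ∁? P?) xs     ≡⟨ cong (_+ weight (Q? ∩? ∁? P?) xs) (weight-≐ (Q? ∩? P?) (P? ∩? Q?) (swap , swap) xs) ⟩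
    weight (P? ∩? Q?) xs + weight (Q? ∩? ∁? P?) xs     ∎)
    where open ≡-Reasoning

  weight-∖-sum≡0 : (P? : Decidable P) (Q? : Decidable Q) (R? : Decidable R) (S? : Decidable S) →
                   (∀ {x} → R x → P x) → (∀ {x} → Q x → S x) → ∀ xs →
                   weight P? xs ≡ weight Q? xs → weight R? xs ≡ weight S? xs →
                   weight (P? ∩? ∁? R?) xs + weight (S? ∩? ∁? Q?) xs ≡ 0
  weight-∖-sum≡0 P? Q? R? S? R⊆P Q⊆S xs wP≡wQ wR≡wS = +-cancelˡ-≡ (weight P? xs) _ 0 (begin
    weight P? xs + (pr + sq)         ≡⟨ cong (weight P? xs +_) (+-comm pr sq) ⟩
    weight P? xs + (sq + pr)         ≡⟨ cong (_+ (sq + pr)) wP≡wQ ⟩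
    weight Q? xs + (sq + pr)         ≡⟨ +-assoc (weight Q? xs) sq pr ⟨
    weight Q? xs + sq + pr           ≡⟨ cong (_+ pr) (weight-⊆ S? Q? Q⊆S xs) ⟨
    weight S? xs + pr                ≡⟨ cong (_+ pr) wR≡wS ⟨
    weight R? xs + pr                ≡⟨ weight-⊆ P? R? R⊆P xs ⟨
    weight P? xs                     ≡⟨ +-identityʳ (weight P? xs) ⟨
    weight P? xs + 0                 ∎)
    where open ≡-Reasoning
          pr sq : ℕ
          pr = weight (P? ∩? ∁? R?) xs
          sq = weight (S? ∩? ∁? Q?) xs

  length≤sum-map : (∀ x → 1 ≤ w x) → ∀ xs → length xs ≤ sum (map w xs)
  length≤sum-map pos []       = z≤n
  length≤sum-map pos (x ∷ xs) = +-mono-≤ (pos x) (length≤sum-map pos xs)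

label : ∀ {n} → (Fin n → Fin n) → Fin n → ℕ
label f v = suc (toℕ (f v))

magic⇒∖-weights-equal : ∀ {n} (G : SimpleGraph n) (f : Fin n ⤖ Fin n) → IsDistanceMagicLabeling G f →
  ∀ u v → weight (label (Bijection.to f)) (∖? (N? G u) (N? G v)) (allFin n)
        ≡ weight (label (Bijection.to f)) (∖? (N? G v) (N? G u)) (allFin n)
magic⇒∖-weights-equal {n} G f (_ , magic) u v =
  weight-∖-cancel (label (Bijection.to f)) (N? G u) (N? G v) (allFin n) (trans (magic u) (sym (magic v)))

theorem2p1 : {n : ℕ} (G : SimpleGraph n) (u₁ u₂ w₁ w₂ : Fin n) →
    ¬ u₁ ≡ u₂ → ¬ u₁ ≡ w₁ → ¬ u₁ ≡ w₂ → ¬ u₂ ≡ w₁ → ¬ u₂ ≡ w₂ → ¬ w₁ ≡ w₂ →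
    Nonempty (N G u₁ ∩ N G u₂) →
    Nonempty (N G w₁ ∩ N G w₂) →
    Nonempty (N G u₁ ∖ N G u₂) →
    Nonempty (N G u₂ ∖ N G u₁) →
    Nonempty (N G w₁ ∖ N G w₂) →
    Nonempty (N G w₂ ∖ N G w₁) →
    (N G w₁ ∖ N G w₂) ⊆ (N G u₁ ∖ N G u₂) →
    (N G u₂ ∖ N G u₁) ⊆ (N G w₂ ∖ N G w₁) →
    card ((N G u₁ ∖ N G u₂) ∖ (N G w₁ ∖ N G w₂))
         (∖? (∖? (N? G u₁) (N? G u₂)) (∖? (N? G w₁) (N? G w₂)))
      + card ((N G w₂ ∖ N G w₁) ∖ (N G u₂ ∖ N G u₁))
         (∖? (∖? (N? G w₂) (N? G w₁)) (∖? (N? G u₂) (N? G u₁)))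
      ≥ 1 →
    NonDistanceMagic G
theorem2p1 {n} G u₁ u₂ w₁ w₂ _ _ _ _ _ _ _ _ _ _ _ _ C⊆A B⊆D cards≥1 (f , isMagic) =
  contradiction (≤-trans cards≥1 cards≤0) λ ()
  where
  ℓ : Fin n → ℕ
  ℓ = label (Bijection.to f)
  A? : Decidable (N G u₁ ∖ N G u₂)
  A? = ∖? (N? G u₁) (N? G u₂)
  B? : Decidable (N G u₂ ∖ N G u₁)
  B? = ∖? (N? G u₂) (N? G u₁)
  C? : Decidable (N G w₁ ∖ N G w₂)
  C? = ∖? (N? G w₁) (N? G w₂)
  D? : Decidable (N G w₂ ∖ N G w₁)
  D? = ∖? (N? G w₂) (N? G w₁)
  labels-positive : ∀ v → 1 ≤ ℓ v
  labels-positive v = s≤s z≤n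
  card≤weight : ∀ {p} {P : Pred (Fin n) p} (P? : Decidable P) → length (filter P? (allFin n)) ≤ weight ℓ P? (allFin n)
  card≤weight P? = length≤sum-map ℓ labels-positive (filter P? (allFin n))
  cards≤0 : card _ (∖? A? C?) + card _ (∖? D? B?) ≤ 0
  cards≤0 = ≤-trans (+-mono-≤ (card≤weight (∖? A? C?)) (card≤weight (∖? D? B?))) (≤-reflexive
    (weight-∖-sum≡0 ℓ A? B? C? D? C⊆A B⊆D (allFin n)
      (magic⇒∖-weights-equal G f isMagic u₁ u₂) (magic⇒∖-weights-equal G f isMagic w₁ w₂)))
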